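{- For every prime $p$, every positive integer $x$, and all positive integers $n,j$ with $n\ge j$, \[ \nu_p\bigl(sf^{(n)}(x)\bigr)=\sum_{i=1}^{x}P_{n-j}(x+1-i)\,\nu_p\bigl(sf^{(j-1)}(i)\bigr). \]
   Context: $\nu_p(m)$ denotes the $p$-adic valuation of a positive integer $m$. For integers $r\ge 0$ and $m\ge 1$, $P_r(m)=\binom{m+r-1}{r}$ is the $r$-simplex (figurate) number (so $P_0(m)=1$). The generalized superfactorial is defined for positive integers $x$ by $sf^{(0)}(x)=x!$ and $sf^{(n)}(x)=\prod_{k=1}^{x}sf^{(n-1)}(k)$ for $n\ge 1$. -}

module Defs where

open import Data.Nat using (ℕ; zero; suc; _+_; _*_; _∸_; _^_; _!)
open import Data.Nat.Divisibility using (_∣?_)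
open import Data.Nat.Combinatorics using (_C_)
open import Relation.Nullary using (yes; no)

largestPowerDividing : ℕ → ℕ → ℕ → ℕ
largestPowerDividing p m zero = zero
largestPowerDividing p m (suc k) with (p ^ suc k) ∣? m
... | yes _ = suc k
... | no  _ = largestPowerDividing p m k

-- p-adic valuation ν_p(m): the largest k with p^k ∣ m.  For a prime p (p ≥ 2)
-- and m ≥ 1 one has p^k ≤ m whenever p^k ∣ m, so k < m and searching k ≤ m
-- is exhaustive.
ν : ℕ → ℕ → ℕ
ν p m = largestPowerDividing p m m

Psimplex : ℕ → ℕ → ℕ
Psimplex r m = (m + r ∸ 1) C r

prod1 : ℕ → (ℕ → ℕ) → ℕ
prod1 zero    f = 1
prod1 (suc x) f = prod1 x f * f (suc x)

sum1 : ℕ → (ℕ → ℕ) → ℕ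
sum1 zero    f = 0
sum1 (suc x) f = sum1 x f + f (suc x)

sf : ℕ → ℕ → ℕ
sf zero    x = x !
sf (suc n) x = prod1 x (sf n)

-- Since ν_p is additive on positive integers, ν_p (sf^(n)(x)) is the
-- (n - j + 1)-fold iterated partial sum of i ↦ ν_p (sf^(j-1)(i)), and an
-- (r + 1)-fold iterated partial sum is a convolution with the r-simplex
-- numbers, by Pascal's rule P_{r+1}(m+1) = P_{r+1}(m) + P_r(m+1).
module Submission where

open import Defs
open import Data.Nat using (ℕ; _+_; _*_; _∸_; _≤_)
open import Data.Nat.Primality using (Prime)
open import Relation.Binary.PropositionalEquality using (_≡_)

open import Data.Nat using (zero; suc; _^_; _<_; z≤n; s≤s; >-nonZero; >-nonZero⁻¹; ≢-nonZero; NonZero)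
open import Data.Nat.Base using (nonTrivial⇒n>1)
open import Data.Nat.Combinatorics using (_C_; nCk+nC[k+1]≡[n+1]C[k+1]; k>n⇒nCk≡0)
open import Data.Nat.Divisibility
open import Data.Nat.Primality using (euclidsLemma; prime⇒nonTrivial)
open import Data.Nat.Properties
open import Algebra.Properties.CommutativeSemigroup +-commutativeSemigroup using (interchange)
open import Data.Product using (Σ-syntax; _×_; _,_)
open import Data.Sum using (inj₁; inj₂; [_,_])
open import Function using (_∘_)
open import Relation.Nullary using (¬_; yes; no)
open import Relation.Nullary.Negation using (contradiction)
open import Relation.Binary.PropositionalEquality
  using (refl; sym; trans; cong; cong₂; subst; subst₂; module ≡-Reasoning)

open ≡-Reasoning

n<m^n : ∀ {m} → 1 < m → ∀ n → n < m ^ n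
n<m^n 1<m zero    = s≤s z≤n
n<m^n 1<m (suc n) = ≤-<-trans (n<m^n 1<m n) (^-monoʳ-< _ 1<m (n<1+n n))

^-monoʳ-∣ : ∀ m {i j} → i ≤ j → m ^ i ∣ m ^ j
^-monoʳ-∣ m {i} {j} i≤j = divides (m ^ (j ∸ i)) (begin
  m ^ j                ≡⟨ cong (m ^_) (sym (m+[n∸m]≡n i≤j)) ⟩
  m ^ (i + (j ∸ i))    ≡⟨ ^-distribˡ-+-* m i (j ∸ i) ⟩
  m ^ i * m ^ (j ∸ i)  ≡⟨ *-comm (m ^ i) _ ⟩
  m ^ (j ∸ i) * m ^ i  ∎)

largestPowerDividing-∣ : ∀ p m b → p ^ largestPowerDividing p m b ∣ m
largestPowerDividing-∣ p m zero = 1∣ m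
largestPowerDividing-∣ p m (suc b) with p ^ suc b ∣? m
... | yes p^b+1∣m = p^b+1∣m
... | no  _       = largestPowerDividing-∣ p m b

largestPowerDividing-maximal : ∀ p m b {k} → k ≤ b → p ^ k ∣ m →
                               k ≤ largestPowerDividing p m b
largestPowerDividing-maximal p m zero    k≤0 _ = k≤0
largestPowerDividing-maximal p m (suc b) k≤b+1 p^k∣m with p ^ suc b ∣? m
... | yes _ = k≤b+1
... | no p^b+1∤m with m≤n⇒m<n∨m≡n k≤b+1
...   | inj₁ (s≤s k≤b) = largestPowerDividing-maximal p m b k≤b p^k∣m
...   | inj₂ refl      = contradiction p^k∣m p^b+1∤m

module _ {p : ℕ} (1<p : 1 < p) where

  private instance
    p≢0 : NonZero p
    p≢0 = >-nonZero (<-trans (s≤s z≤n) 1<p)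

  ν-∣ : ∀ m → p ^ ν p m ∣ m
  ν-∣ m = largestPowerDividing-∣ p m m

  ν-maximal : ∀ {m k} → 0 < m → p ^ k ∣ m → k ≤ ν p m
  ν-maximal {m} {k} 0<m p^k∣m = largestPowerDividing-maximal p m m k≤m p^k∣m
    where
    k≤m : k ≤ m
    k≤m = <⇒≤ (<-≤-trans (n<m^n 1<p k) (∣⇒≤ {{>-nonZero 0<m}} p^k∣m))

  ν-p^k*q : ∀ k {q} → ¬ p ∣ q → ν p (p ^ k * q) ≡ k
  ν-p^k*q k {q} p∤q = ≤-antisym ν≤k (ν-maximal 0<p^k*q (m∣m*n q))
    where
    instance
      p^k≢0 : NonZero (p ^ k)
      p^k≢0 = m^n≢0 p k
      q≢0 : NonZero q
      q≢0 = ≢-nonZero λ { refl → p∤q (p ∣0) }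
    0<p^k*q : 0 < p ^ k * q
    0<p^k*q = >-nonZero⁻¹ (p ^ k * q) {{m*n≢0 (p ^ k) q}}
    ν≤k : ν p (p ^ k * q) ≤ k
    ν≤k = ≮⇒≥ λ k<ν → p∤q (*-cancelˡ-∣ (p ^ k) (p^[k+1]∣p^k*q k<ν))
      where
      p^[k+1]∣p^k*q : k < ν p (p ^ k * q) → p ^ k * p ∣ p ^ k * q
      p^[k+1]∣p^k*q k<ν = subst (_∣ p ^ k * q) (*-comm p (p ^ k))
        (∣-trans (^-monoʳ-∣ p k<ν) (ν-∣ (p ^ k * q)))

  ν-1 : ν p 1 ≡ 0
  ν-1 = ν-p^k*q 0 λ p∣1 → <⇒≢ 1<p (sym (∣1⇒≡1 p∣1))

  ν-factorisation : ∀ {m} → 0 < m → Σ[ q ∈ ℕ ] m ≡ p ^ ν p m * q × ¬ p ∣ q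
  ν-factorisation {m} 0<m = quotient (ν-∣ m) , m∣n⇒n≡m*quotient (ν-∣ m) , p∤q
    where
    p∤q : ¬ p ∣ quotient (ν-∣ m)
    p∤q p∣q = n≮n (ν p m) (ν-maximal 0<m p^[ν+1]∣m)
      where
      p^[ν+1]∣m : p ^ suc (ν p m) ∣ m
      p^[ν+1]∣m = subst₂ _∣_ (*-comm (p ^ ν p m) p) (sym (m∣n⇒n≡m*quotient (ν-∣ m)))
        (*-monoʳ-∣ (p ^ ν p m) p∣q)

prime⇒>1 : ∀ {p} → Prime p → 1 < p
prime⇒>1 {p} pp = nonTrivial⇒n>1 p {{prime⇒nonTrivial pp}}

ν-* : ∀ {p a b} → Prime p → 0 < a → 0 < b → ν p (a * b) ≡ ν p a + ν p b
ν-* {p} {a} {b} pp 0<a 0<b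
  with ν-factorisation (prime⇒>1 pp) 0<a | ν-factorisation (prime⇒>1 pp) 0<b
... | qa , a≡p^α*qa , p∤qa | qb , b≡p^β*qb , p∤qb = begin
  ν p (a * b)                               ≡⟨ cong (ν p) (cong₂ _*_ a≡p^α*qa b≡p^β*qb) ⟩
  ν p ((p ^ α * qa) * (p ^ β * qb))         ≡⟨ cong (ν p) ([m*n]*[o*p]≡[m*o]*[n*p] (p ^ α) qa (p ^ β) qb) ⟩
  ν p ((p ^ α * p ^ β) * (qa * qb))         ≡⟨ cong (λ t → ν p (t * (qa * qb))) (^-distribˡ-+-* p α β) ⟨
  ν p (p ^ (α + β) * (qa * qb))             ≡⟨ ν-p^k*q (prime⇒>1 pp) (α + β) p∤qa*qb ⟩
  α + β                                     ∎
  where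
  α β : ℕ
  α = ν p a
  β = ν p b
  p∤qa*qb : ¬ p ∣ qa * qb
  p∤qa*qb = [ p∤qa , p∤qb ] ∘ euclidsLemma qa qb pp

prod1-pos : ∀ x {f} → (∀ i → 0 < f i) → 0 < prod1 x f
prod1-pos zero    f>0 = s≤s z≤n
prod1-pos (suc x) f>0 = *-mono-≤ (prod1-pos x f>0) (f>0 (suc x))

ν-prod1 : ∀ {p} → Prime p → ∀ x {f} → (∀ i → 0 < f i) →
          ν p (prod1 x f) ≡ sum1 x (ν p ∘ f)
ν-prod1 pp zero    f>0 = ν-1 (prime⇒>1 pp)
ν-prod1 {p} pp (suc x) {f} f>0 =
  trans (ν-* pp (prod1-pos x f>0) (f>0 (suc x))) (cong (_+ ν p (f (suc x))) (ν-prod1 pp x f>0))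

sf-pos : ∀ n x → 0 < sf n x
sf-pos zero    x = 1≤n! x
sf-pos (suc n) x = prod1-pos x (sf-pos n)

sum1-cong : ∀ x {f g : ℕ → ℕ} → (∀ i → i ≤ x → f i ≡ g i) → sum1 x f ≡ sum1 x g
sum1-cong zero    f≗g = refl
sum1-cong (suc x) f≗g =
  cong₂ _+_ (sum1-cong x λ i i≤x → f≗g i (m≤n⇒m≤1+n i≤x)) (f≗g (suc x) ≤-refl)

sum1-distrib-+ : ∀ x (f g : ℕ → ℕ) → sum1 x (λ i → f i + g i) ≡ sum1 x f + sum1 x g
sum1-distrib-+ zero    f g = refl
sum1-distrib-+ (suc x) f g = trans (cong (_+ (f (suc x) + g (suc x))) (sum1-distrib-+ x f g))
  (interchange (sum1 x f) (sum1 x g) (f (suc x)) (g (suc x)))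

iteratedSum : ℕ → (ℕ → ℕ) → ℕ → ℕ
iteratedSum zero    a   = a
iteratedSum (suc r) a x = sum1 x (iteratedSum r a)

ν-sf-+ : ∀ {p} → Prime p → ∀ r k x → ν p (sf (r + k) x) ≡ iteratedSum r (ν p ∘ sf k) x
ν-sf-+ pp zero    k x = refl
ν-sf-+ pp (suc r) k x =
  trans (ν-prod1 pp x (sf-pos (r + k))) (sum1-cong x λ i _ → ν-sf-+ pp r k i)

figurateSum : ℕ → (ℕ → ℕ) → ℕ → ℕ
figurateSum r a x = sum1 x (λ i → Psimplex r (x + 1 ∸ i) * a i)

Psimplex-pascal : ∀ r m → Psimplex (suc r) (suc m) ≡ Psimplex (suc r) m + Psimplex r (suc m)
Psimplex-pascal r m rewrite +-suc m r =
  trans (sym (nCk+nC[k+1]≡[n+1]C[k+1] (m + r) r)) (+-comm ((m + r) C r) _)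

Psimplex-suc-zero : ∀ r → Psimplex (suc r) 0 ≡ 0
Psimplex-suc-zero r = k>n⇒nCk≡0 (n<1+n r)

figurateSum-suc : ∀ r a x →
  figurateSum (suc r) a (suc x) ≡ figurateSum (suc r) a x + figurateSum r a (suc x)
figurateSum-suc r a x = begin
  figurateSum (suc r) a (suc x)
    ≡⟨ sum1-cong (suc x) pascal-term ⟩
  sum1 (suc x) (λ i → P′ (x + 1 ∸ i) * a i + Psimplex r (suc x + 1 ∸ i) * a i)
    ≡⟨ sum1-distrib-+ (suc x) _ _ ⟩
  figurateSum (suc r) a x + P′ (x + 1 ∸ suc x) * a (suc x) + figurateSum r a (suc x)
    ≡⟨ cong (λ t → figurateSum (suc r) a x + t + figurateSum r a (suc x)) last-term≡0 ⟩
  figurateSum (suc r) a x + 0 + figurateSum r a (suc x)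
    ≡⟨ cong (_+ figurateSum r a (suc x)) (+-identityʳ (figurateSum (suc r) a x)) ⟩
  figurateSum (suc r) a x + figurateSum r a (suc x)
    ∎
  where
  P′ : ℕ → ℕ
  P′ = Psimplex (suc r)
  last-term≡0 : P′ (x + 1 ∸ suc x) * a (suc x) ≡ 0
  last-term≡0 = begin
    P′ (x + 1 ∸ suc x) * a (suc x)  ≡⟨ cong (λ m → P′ m * a (suc x)) (m≤n⇒m∸n≡0 (≤-reflexive (+-comm x 1))) ⟩
    P′ 0 * a (suc x)                ≡⟨ cong (_* a (suc x)) (Psimplex-suc-zero r) ⟩
    0                               ∎
  pascal-term : ∀ i → i ≤ suc x →
    P′ (suc x + 1 ∸ i) * a i ≡ P′ (x + 1 ∸ i) * a i + Psimplex r (suc x + 1 ∸ i) * a i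
  pascal-term i i≤1+x = begin
    P′ (suc x + 1 ∸ i) * a i                             ≡⟨ cong (λ m → P′ m * a i) shift ⟩
    P′ (suc m) * a i                                     ≡⟨ cong (_* a i) (Psimplex-pascal r m) ⟩
    (P′ m + Psimplex r (suc m)) * a i                    ≡⟨ *-distribʳ-+ (a i) (P′ m) _ ⟩
    P′ m * a i + Psimplex r (suc m) * a i                ≡⟨ cong (λ n → P′ m * a i + Psimplex r n * a i) shift ⟨
    P′ m * a i + Psimplex r (suc x + 1 ∸ i) * a i        ∎
    where
    m : ℕ
    m = x + 1 ∸ i
    shift : suc x + 1 ∸ i ≡ suc m
    shift = +-∸-assoc 1 (subst (i ≤_) (+-comm 1 x) i≤1+x)

sum1-figurateSum : ∀ r a x → sum1 x (figurateSum r a) ≡ figurateSum (suc r) a x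
sum1-figurateSum r a zero    = refl
sum1-figurateSum r a (suc x) =
  trans (cong (_+ figurateSum r a (suc x)) (sum1-figurateSum r a x)) (sym (figurateSum-suc r a x))

iteratedSum≡figurateSum : ∀ r a x → iteratedSum (suc r) a x ≡ figurateSum r a x
iteratedSum≡figurateSum zero    a x = sum1-cong x λ i _ → sym (*-identityˡ (a i))
iteratedSum≡figurateSum (suc r) a x =
  trans (sum1-cong x λ i _ → iteratedSum≡figurateSum r a i) (sum1-figurateSum r a x)

corollary8p2 : (p x n j : ℕ) → Prime p → 1 ≤ x → 1 ≤ j → j ≤ n →
    ν p (sf n x) ≡ sum1 x (λ i → Psimplex (n ∸ j) (x + 1 ∸ i) * ν p (sf (j ∸ 1) i))
corollary8p2 p x n (suc k) pp _ _ 1+k≤n = begin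
  ν p (sf n x)                                       ≡⟨ cong (λ m → ν p (sf m x)) n≡[n∸[1+k]+1]+k ⟩
  ν p (sf (suc (n ∸ suc k) + k) x)                   ≡⟨ ν-sf-+ pp (suc (n ∸ suc k)) k x ⟩
  iteratedSum (suc (n ∸ suc k)) (ν p ∘ sf k) x       ≡⟨ iteratedSum≡figurateSum (n ∸ suc k) (ν p ∘ sf k) x ⟩
  figurateSum (n ∸ suc k) (ν p ∘ sf k) x             ∎
  where
  n≡[n∸[1+k]+1]+k : n ≡ suc (n ∸ suc k) + k
  n≡[n∸[1+k]+1]+k = trans (sym (m∸n+n≡m 1+k≤n)) (+-suc (n ∸ suc k) k)
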